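{- Let $d\in\{2,4,8,16\}$ and let $K$ be a $(3d/2+3)$-vertex combinatorial $d$-manifold like a projective plane. Suppose that $J_1$ and $J_2$ are two distinguished subcomplexes of $K$ with disjoint interiors, i.e., having no common $d$-simplices. Then $J_2$ remains a distinguished subcomplex (so the corresponding triple flip remains defined) after performing the triple flip corresponding to $J_1$, and vice versa. Moreover, the triple flips corresponding to $J_1$ and $J_2$ commute.
   Context: A combinatorial $d$-manifold is a simplicial complex in which the link of each vertex is PL homeomorphic to $S^{d-1}$; it is like a projective plane if it admits a PL Morse function with exactly three critical points. The link of a simplex $\sigma$ in $K$ (vertex set $V$) is $\mathrm{link}(\sigma,K)=\{\tau\subseteq V\setminus\sigma\colon\sigma\cup\tau\in K\}$. A distinguished triple in $K$ is a triple $(\Delta_1,\Delta_2,\Delta_3)$ of $(d/2)$-simplices with $\mathrm{link}(\Delta_1,K)=\partial\Delta_2$, $\mathrm{link}(\Delta_2,K)=\partial\Delta_3$, $\mathrm{link}(\Delta_3,K)=\partial\Delta_1$; the corresponding distinguished subcomplex is $J=(\Delta_1*\partial\Delta_2)\cup(\Delta_2*\partial\Delta_3)\cup(\Delta_3*\partial\Delta_1)$, where $*$ is the join. The triple flip corresponding to $J$ replaces $J$ by $\widetilde{J}=(\partial\Delta_1*\Delta_2)\cup(\partial\Delta_2*\Delta_3)\cup(\partial\Delta_3*\Delta_1)$, i.e., produces the complex $(K\setminus J)\cup\widetilde J$ (as sets of simplices). The same definition of distinguished subcomplex applies to the complex obtained after a flip. -}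

module Defs where

open import Data.Bool using (Bool; true; false; _∧_; _∨_; not; _xor_; if_then_else_)
open import Data.Nat using (ℕ; zero; suc; _+_; _<ᵇ_)
open import Data.Fin using (Fin)
open import Data.List using (List; allFin)
import Data.List as L
open import Data.Vec using (Vec; []; _∷_; lookup; tabulate; zipWith; foldr)
open import Data.Fin.Subset using (Subset; _∪_; _∩_; ⁅_⁆; ∣_∣; ⊥; inside; outside)
open import Data.Fin.Subset.Properties using (_⊆?_)
open import Data.Product using (Σ; _×_; ∃)
open import Data.Sum using (_⊎_)
open import Relation.Nullary using (¬_; does)
open import Relation.Binary.PropositionalEquality using (_≡_)
open import Function using (_↔_)

-- Finite abstract simplicial complexes on the vertex set Fin n.
-- A "complex" is the (decidable) set of its simplices, including the
-- empty simplex; simplices are subsets of Fin n.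

Cplx : ℕ → Set
Cplx n = Subset n → Bool

private variable m n : ℕ

_⊆ᵇ_ : Subset n → Subset n → Bool
σ ⊆ᵇ τ = does (σ ⊆? τ)

_≡ᵇ_ : Subset n → Subset n → Bool
σ ≡ᵇ τ = (σ ⊆ᵇ τ) ∧ (τ ⊆ᵇ σ)

disjᵇ : Subset n → Subset n → Bool
disjᵇ σ τ = (σ ∩ τ) ⊆ᵇ ⊥

_≐_ : Cplx n → Cplx n → Set
K ≐ L = ∀ σ → K σ ≡ L σ

IsComplex : Cplx n → Set
IsComplex {n} K = (K ⊥ ≡ true) × (∀ (σ τ : Subset n) → (σ ⊆ᵇ τ) ≡ true → K τ ≡ true → K σ ≡ true)

⟪_⟫ : Subset n → Cplx n
⟪ Δ ⟫ σ = σ ⊆ᵇ Δ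

∂ : Subset n → Cplx n
∂ Δ σ = (σ ⊆ᵇ Δ) ∧ not (Δ ⊆ᵇ σ)

infixr 5 _∪ᶜ_
_∪ᶜ_ : Cplx n → Cplx n → Cplx n
(K ∪ᶜ L) σ = K σ ∨ L σ

_∖ᶜ_ : Cplx n → Cplx n → Cplx n
(K ∖ᶜ L) σ = K σ ∧ not (L σ)

link : Subset n → Cplx n → Cplx n
link σ K τ = disjᵇ σ τ ∧ K (σ ∪ τ)

-- Join A * B of a complex A with vertex set VA and a complex B with
-- vertex set VB, where VA and VB are disjoint:
-- A * B = { α ∪ β : α ∈ A, β ∈ B }.
join : Subset n → Cplx n → Subset n → Cplx n → Cplx n
join VA A VB B σ = (σ ⊆ᵇ (VA ∪ VB)) ∧ A (σ ∩ VA) ∧ B (σ ∩ VB)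

_*∂_ : Subset n → Subset n → Cplx n
Δ *∂ Δ' = join Δ ⟪ Δ ⟫ Δ' (∂ Δ')

_∂*_ : Subset n → Subset n → Cplx n
Δ ∂* Δ' = join Δ (∂ Δ) Δ' ⟪ Δ' ⟫

-- PL spheres, via bistellar moves (Pachner's theorem).

record BistellarMove (k : ℕ) (K : Cplx n) (A B : Subset n) : Set where
  field
    disjoint : disjᵇ A B ≡ true
    A-nonempty : ¬ (A ≡ ⊥)
    B-nonempty : ¬ (B ≡ ⊥)
    size : ∣ A ∣ + ∣ B ∣ ≡ k + 2
    link-A : link A K ≐ ∂ B
    B-notin : K B ≡ false

bistellar : Cplx n → Subset n → Subset n → Cplx n
bistellar K A B = (K ∖ᶜ (A *∂ B)) ∪ᶜ (A ∂* B)

extend : Cplx m → Cplx (suc m)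
extend K (inside ∷ σ) = false
extend K (outside ∷ σ) = K σ

relabel : (Fin m → Fin m) → Cplx m → Cplx m
relabel π K σ = K (tabulate (λ i → lookup σ (π i)))

data PLSphere (k : ℕ) : (m : ℕ) → Cplx m → Set where
  simplexBoundary : ∀ {m} (Δ : Subset m) → ∣ Δ ∣ ≡ k + 2 → PLSphere k m (∂ Δ)
  move : ∀ {m K} (A B : Subset m) → BistellarMove k K A B → PLSphere k m K →
         PLSphere k m (bistellar K A B)
  congr : ∀ {m K L} → K ≐ L → PLSphere k m K → PLSphere k m L
  addVertex : ∀ {m K} → PLSphere k m K → PLSphere k (suc m) (extend K)
  removeVertex : ∀ {m K} → PLSphere k (suc m) (extend K) → PLSphere k m K
  rename : ∀ {m K} (π : Fin m ↔ Fin m) → PLSphere k m K →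
           PLSphere k m (relabel (Function.Inverse.to π) K)

-- Combinatorial d-manifold on the vertex set Fin n (every i : Fin n is a
-- vertex): the link of every vertex is a PL (d-1)-sphere.
-- (Stated for d ≥ 1; we write the sphere dimension as k = d - 1 via d = suc k.)
record CombManifold (d : ℕ) (K : Cplx n) : Set where
  field
    complex : IsComplex K
    allVertices : ∀ (v : Fin n) → K ⁅ v ⁆ ≡ true
    links : ∀ (k : ℕ) → d ≡ suc k → ∀ (v : Fin n) → PLSphere k n (link ⁅ v ⁆ K)

-- A chain is a Boolean function on simplices (all degrees at once,
-- including the empty simplex in degree -1: augmented = reduced complex).
-- Since the boundary map is homogeneous of degree -1, the homology of this
-- total complex is the direct sum of all reduced homology groups H̃_i(L;Z/2).

Chain : ℕ → Set
Chain n = Subset n → Bool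

parity : List Bool → Bool
parity = L.foldr _xor_ false

bdry : Chain n → Chain n
bdry {n} c σ = parity (L.map (λ v → not (lookup σ v) ∧ c (σ ∪ ⁅ v ⁆)) (allFin n))

_+ᶜ_ : Chain n → Chain n → Chain n
(c +ᶜ c') σ = c σ xor c' σ

SupportedIn : Cplx n → Chain n → Set
SupportedIn K c = ∀ σ → c σ ≡ true → K σ ≡ true

IsCycle : Chain n → Set
IsCycle c = bdry c ≐ (λ _ → false)

IsBoundaryIn : Cplx n → Chain n → Set
IsBoundaryIn K c = Σ (Chain _) (λ e → SupportedIn K e × (bdry e ≐ c))

ReducedHomologyNonzero : Cplx n → Set
ReducedHomologyNonzero K =
  Σ (Chain _) (λ z → SupportedIn K z × IsCycle z × ¬ IsBoundaryIn K z)

ReducedHomologyDimLe1 : Cplx n → Set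
ReducedHomologyDimLe1 K = ∀ z z' → SupportedIn K z → SupportedIn K z' →
  IsCycle z → IsCycle z' →
  IsBoundaryIn K z ⊎ IsBoundaryIn K z' ⊎ IsBoundaryIn K (z +ᶜ z')

-- A PL function on |K| that is linear on simplices and
-- generic is determined (up to order, which is all that matters) by an
-- injective function on the vertices.  The lower link of v is
-- link_-(v) = { σ ∈ link(v,K) : f(u) < f(v) for all u ∈ σ };
-- H_*(K_{≤f(v)}, K_{<f(v)}) ≅ H̃_{*-1}(link_-(v)).  v is critical iff this is
-- nonzero; f is a (nondegenerate) PL Morse function iff it has rank ≤ 1 at every v.

lowerLink : (Fin n → ℕ) → Fin n → Cplx n → Cplx n
lowerLink {n} f v K σ =
  link ⁅ v ⁆ K σ ∧ L.foldr _∧_ true (L.map (λ u → not (lookup σ u) ∨ (f u <ᵇ f v)) (allFin n))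

Critical : Cplx n → (Fin n → ℕ) → Fin n → Set
Critical K f v = ReducedHomologyNonzero (lowerLink f v K)

record PLMorse (K : Cplx n) (f : Fin n → ℕ) : Set where
  field
    injective : ∀ u v → f u ≡ f v → u ≡ v
    nondegenerate : ∀ v → ReducedHomologyDimLe1 (lowerLink f v K)

LikeProjectivePlane : Cplx n → Set
LikeProjectivePlane {n} K = Σ (Fin n → ℕ) λ f → PLMorse K f ×
  Σ (Fin n) λ a → Σ (Fin n) λ b → Σ (Fin n) λ c →
    ¬ (a ≡ b) × ¬ (b ≡ c) × ¬ (a ≡ c) ×
    (∀ v → (Critical K f v → (v ≡ a ⊎ v ≡ b ⊎ v ≡ c)) ×
           ((v ≡ a ⊎ v ≡ b ⊎ v ≡ c) → Critical K f v))

record Triple (n : ℕ) : Set where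
  constructor triple
  field
    Δ₁ Δ₂ Δ₃ : Subset n

record IsDistinguishedTriple (d : ℕ) (K : Cplx n) (T : Triple n) : Set where
  open Triple T
  field
    size₁ : ∣ Δ₁ ∣ ≡ Data.Nat._/_ d 2 + 1
    size₂ : ∣ Δ₂ ∣ ≡ Data.Nat._/_ d 2 + 1
    size₃ : ∣ Δ₃ ∣ ≡ Data.Nat._/_ d 2 + 1
    link₁ : link Δ₁ K ≐ ∂ Δ₂
    link₂ : link Δ₂ K ≐ ∂ Δ₃
    link₃ : link Δ₃ K ≐ ∂ Δ₁

distSub : Triple n → Cplx n
distSub (triple Δ₁ Δ₂ Δ₃) = (Δ₁ *∂ Δ₂) ∪ᶜ (Δ₂ *∂ Δ₃) ∪ᶜ (Δ₃ *∂ Δ₁)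

distSub~ : Triple n → Cplx n
distSub~ (triple Δ₁ Δ₂ Δ₃) = (Δ₁ ∂* Δ₂) ∪ᶜ (Δ₂ ∂* Δ₃) ∪ᶜ (Δ₃ ∂* Δ₁)

tripleFlip : Cplx n → Triple n → Cplx n
tripleFlip K T = (K ∖ᶜ distSub T) ∪ᶜ distSub~ T

{-# OPTIONS --safe #-}
-- Write J = distSub T, J̃ = distSub~ T for a distinguished triple T = (Δ₁, Δ₂, Δ₃). The flip along T
-- changes only simplices of J ∪ J̃; each of them lies in Δ₁ ∪ Δ₂, Δ₂ ∪ Δ₃ or Δ₃ ∪ Δ₁, and each
-- simplex of J ∖ J̃ contains some Δᵢ. Since link(Δ₁) = ∂Δ₂, every simplex of K containing Δ₁ lies in
-- Δ₁ * ∂Δ₂ ⊆ J. The key fact is that no Δ′ᵢ of a second triple T′ lies in one of those unions for T: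
-- if Δ′₁ ⊆ Δ₁ ∪ Δ₂, take v ∈ Δ₂ ∖ Δ′₁; then the d-simplex Δ₁ ∪ (Δ₂ - v) of J contains Δ′₁, so it
-- also lies in J′, against the disjointness of the interiors. (If Δ₂ ⊆ Δ′₁, then Δ′₁ lies in
-- Δ₂ * ∂Δ₃, and the same argument runs with (Δ₂, Δ₃) and a vertex v ∈ Δ₃.) Hence the flip along T fixes every simplex containing some Δ′ᵢ,
-- so the links of the Δ′ᵢ are unchanged; and a simplex touched by both flips lies in J̃ ∩ J̃′, where
-- both flips make it present, so they commute.
module Submission where

open import Defs
open import Data.Bool using (true; false; _∧_; _∨_; not)
open import Data.Bool.Properties
  using (∧-conicalˡ; ∧-conicalʳ; ∧-identityʳ; ∨-identityʳ; ∨-zeroʳ; ∨-assoc; ∨-comm; ¬-not)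
open import Data.Empty using (⊥-elim)
open import Data.Fin using (Fin; zero; suc)
open import Data.Fin.Properties using (any?)
open import Data.Fin.Subset
  using (Subset; ∣_∣; _∈_; _∉_; _⊆_; _⊈_; _⊂_; _∪_; _∩_; ∁; ⁅_⁆; _-_; Nonempty; inside; outside)
  renaming (⊥ to ∅)
open import Data.Fin.Subset.Properties
  using (_⊆?_; _∈?_; nonempty?; Empty-unique; ⊆-trans; ⊆-antisym; ∉⊥; ⊥⊆; ∣⊥∣≡0; p⊆q⇒∣p∣≤∣q∣;
         x∈⁅x⁆; x∈⁅y⁆⇒x≡y; ∣⁅x⁆∣≡1; x∈∁p⇒x∉p; x∉p⇒x∈∁p; p∩q⊆p; p∩q⊆q; x∈p∩q⁺; x∈p∩q⁻;
         p⊆p∪q; x∈p∪q⁺; x∈p∪q⁻; ∪-identityʳ; p─⊥≡p; p─q⊆p; x∈p∧x≢y⇒x∈p-y; x∈p⇒p-x⊂p)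
open import Data.Nat using (ℕ; suc; _+_; _*_; _/_; _≤_; _<_; s≤s; z≤n)
open import Data.Nat.DivMod using (m*[n/m]≡n; m≥n⇒m/n>0)
open import Data.Nat.Divisibility using (_∣_; divides)
open import Data.Nat.Properties
  using (+-assoc; +-suc; +-comm; +-identityʳ; +-monoˡ-≤; suc-injective; ≤-trans; n≮n)
open import Data.Product using (_×_; _,_; ∃; proj₁; proj₂)
open import Data.Sum using (_⊎_; inj₁; inj₂; [_,_]; map)
open import Data.Vec using ([]; _∷_; here; there)
open import Function using (_∘_; id)
open import Relation.Nullary using (¬_; yes; no; contradiction)
open import Relation.Nullary.Decidable using (dec-true; dec-false; decidable-stable; _×-dec_; ¬?)
open import Relation.Binary.PropositionalEquality
  using (_≡_; refl; sym; trans; cong; cong₂; subst; module ≡-Reasoning)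

open Triple
open IsDistinguishedTriple

private variable
  n : ℕ
  v : Fin n
  p q σ τ Δ Γ : Subset n
  K : Cplx n
  T T₁ T₂ : Triple n

Disjoint : Subset n → Subset n → Set
Disjoint p q = ∀ {x} → x ∈ p → x ∉ q

⊆-or-∃∉ : (p q : Subset n) → p ⊆ q ⊎ ∃ λ x → x ∈ p × x ∉ q
⊆-or-∃∉ p q with any? (λ x → x ∈? p ×-dec ¬? (x ∈? q))
... | yes witness = inj₂ witness
... | no none = inj₁ λ {x} x∈p → decidable-stable (x ∈? q) (λ x∉q → none (x , x∈p , x∉q))

p⊆q⇒p∪[q∩∁p]≡q : p ⊆ q → p ∪ (q ∩ ∁ p) ≡ q
p⊆q⇒p∪[q∩∁p]≡q {p = p} {q} p⊆q = ⊆-antisym ⊆q q⊆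
  where
  ⊆q : p ∪ (q ∩ ∁ p) ⊆ q
  ⊆q x∈ = [ p⊆q , p∩q⊆p q (∁ p) ] (x∈p∪q⁻ p _ x∈)
  q⊆ : q ⊆ p ∪ (q ∩ ∁ p)
  q⊆ {x} x∈q with x ∈? p
  ... | yes x∈p = x∈p∪q⁺ (inj₁ x∈p)
  ... | no x∉p = x∈p∪q⁺ (inj₂ (x∈p∩q⁺ (x∈q , x∉p⇒x∈∁p x∉p)))

Disjoint-∷⁻ : ∀ {s t} → Disjoint (s ∷ p) (t ∷ q) → Disjoint p q
Disjoint-∷⁻ p∩q=∅ x∈p x∈q = p∩q=∅ (there x∈p) (there x∈q)

disjoint⇒∣p∪q∣≡∣p∣+∣q∣ : (p q : Subset n) → Disjoint p q → ∣ p ∪ q ∣ ≡ ∣ p ∣ + ∣ q ∣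
disjoint⇒∣p∪q∣≡∣p∣+∣q∣ []            []            _     = refl
disjoint⇒∣p∪q∣≡∣p∣+∣q∣ (inside  ∷ p) (inside  ∷ q) p∩q=∅ = ⊥-elim (p∩q=∅ here here)
disjoint⇒∣p∪q∣≡∣p∣+∣q∣ (inside  ∷ p) (outside ∷ q) p∩q=∅ =
  cong suc (disjoint⇒∣p∪q∣≡∣p∣+∣q∣ p q (Disjoint-∷⁻ p∩q=∅))
disjoint⇒∣p∪q∣≡∣p∣+∣q∣ (outside ∷ p) (inside  ∷ q) p∩q=∅ =
  trans (cong suc (disjoint⇒∣p∪q∣≡∣p∣+∣q∣ p q (Disjoint-∷⁻ p∩q=∅))) (sym (+-suc ∣ p ∣ ∣ q ∣))
disjoint⇒∣p∪q∣≡∣p∣+∣q∣ (outside ∷ p) (outside ∷ q) p∩q=∅ =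
  disjoint⇒∣p∪q∣≡∣p∣+∣q∣ p q (Disjoint-∷⁻ p∩q=∅)

x∈p⇒suc∣p-x∣≡∣p∣ : (p : Subset n) (x : Fin n) → x ∈ p → suc ∣ p - x ∣ ≡ ∣ p ∣
x∈p⇒suc∣p-x∣≡∣p∣ (inside ∷ p) zero here = cong (suc ∘ ∣_∣) (p─⊥≡p p)
x∈p⇒suc∣p-x∣≡∣p∣ (inside ∷ p) (suc x) (there x∈p) = cong suc (x∈p⇒suc∣p-x∣≡∣p∣ p x x∈p)
x∈p⇒suc∣p-x∣≡∣p∣ (outside ∷ p) (suc x) (there x∈p) = x∈p⇒suc∣p-x∣≡∣p∣ p x x∈p

x∉p-x : (p : Subset n) (x : Fin n) → x ∉ p - x
x∉p-x (_ ∷ p) zero ()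
x∉p-x (_ ∷ p) (suc x) (there x∈p-x) = x∉p-x p x x∈p-x

∣p∣>0⇒nonempty : ∀ {n} {p : Subset n} → 0 < ∣ p ∣ → Nonempty p
∣p∣>0⇒nonempty {n = n} {p = p} 0<∣p∣ with nonempty? p
... | yes ne = ne
... | no empty = ⊥-elim (n≮n 0 (subst (0 <_) (trans (cong ∣_∣ (Empty-unique empty)) (∣⊥∣≡0 n)) 0<∣p∣))

⊆⇒⊆ᵇ : σ ⊆ τ → σ ⊆ᵇ τ ≡ true
⊆⇒⊆ᵇ {σ = σ} {τ} = dec-true (σ ⊆? τ)

⊈⇒⊆ᵇ≡false : σ ⊈ τ → σ ⊆ᵇ τ ≡ false
⊈⇒⊆ᵇ≡false {σ = σ} {τ} = dec-false (σ ⊆? τ)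

⊆ᵇ⇒⊆ : σ ⊆ᵇ τ ≡ true → σ ⊆ τ
⊆ᵇ⇒⊆ {σ = σ} {τ} e with σ ⊆? τ | e
... | yes σ⊆τ | _ = σ⊆τ

disjᵇ⇒Disjoint : disjᵇ σ τ ≡ true → Disjoint σ τ
disjᵇ⇒Disjoint e x∈σ x∈τ = ∉⊥ (⊆ᵇ⇒⊆ e (x∈p∩q⁺ (x∈σ , x∈τ)))

Disjoint⇒disjᵇ : Disjoint σ τ → disjᵇ σ τ ≡ true
Disjoint⇒disjᵇ {σ = σ} {τ} dj = ⊆⇒⊆ᵇ λ x∈σ∩τ → let x∈σ , x∈τ = x∈p∩q⁻ σ τ x∈σ∩τ in ⊥-elim (dj x∈σ x∈τ)

∂⁺ : σ ⊆ Δ → Δ ⊈ σ → ∂ Δ σ ≡ true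
∂⁺ σ⊆Δ Δ⊈σ = cong₂ (λ a b → a ∧ not b) (⊆⇒⊆ᵇ σ⊆Δ) (⊈⇒⊆ᵇ≡false Δ⊈σ)

⊂⇒∂ : σ ⊂ Δ → ∂ Δ σ ≡ true
⊂⇒∂ (σ⊆Δ , x , x∈Δ , x∉σ) = ∂⁺ σ⊆Δ (λ Δ⊆σ → x∉σ (Δ⊆σ x∈Δ))

∂⁻ : ∂ Δ σ ≡ true → σ ⊆ Δ × Δ ⊈ σ
∂⁻ {Δ = Δ} {σ} e with σ ⊆? Δ | Δ ⊆? σ | e
... | yes σ⊆Δ | no Δ⊈σ | _ = σ⊆Δ , Δ⊈σ

∈join : ∀ {VA VB} (A B : Cplx n) → σ ⊆ VA ∪ VB → A (σ ∩ VA) ≡ true → B (σ ∩ VB) ≡ true →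
        join VA A VB B σ ≡ true
∈join _ _ σ⊆ a b = cong₂ _∧_ (⊆⇒⊆ᵇ σ⊆) (cong₂ _∧_ a b)

join⇒⊆ : ∀ VA VB (A B : Cplx n) σ → join VA A VB B σ ≡ true → σ ⊆ VA ∪ VB
join⇒⊆ VA VB A B σ e = ⊆ᵇ⇒⊆ (∧-conicalˡ (σ ⊆ᵇ (VA ∪ VB)) (A (σ ∩ VA) ∧ B (σ ∩ VB)) e)

*∂⇒⊆ : ∀ (Δ Γ : Subset n) σ → (Δ *∂ Γ) σ ≡ true → σ ⊆ Δ ∪ Γ
*∂⇒⊆ Δ Γ = join⇒⊆ Δ Γ ⟪ Δ ⟫ (∂ Γ)

∂*⇒⊆ : ∀ (Δ Γ : Subset n) σ → (Δ ∂* Γ) σ ≡ true → σ ⊆ Δ ∪ Γ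
∂*⇒⊆ Δ Γ = join⇒⊆ Δ Γ (∂ Δ) ⟪ Γ ⟫

∈*∂ : σ ⊆ Δ ∪ Γ → Γ ⊈ σ → (Δ *∂ Γ) σ ≡ true
∈*∂ {σ = σ} {Δ} {Γ} σ⊆ Γ⊈σ = ∈join ⟪ Δ ⟫ (∂ Γ) σ⊆
  (⊆⇒⊆ᵇ (p∩q⊆q σ Δ)) (∂⁺ (p∩q⊆q σ Γ) (λ Γ⊆ → Γ⊈σ (⊆-trans Γ⊆ (p∩q⊆p σ Γ))))

∈∂* : σ ⊆ Δ ∪ Γ → Δ ⊈ σ → (Δ ∂* Γ) σ ≡ true
∈∂* {σ = σ} {Δ} {Γ} σ⊆ Δ⊈σ = ∈join (∂ Δ) ⟪ Γ ⟫ σ⊆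
  (∂⁺ (p∩q⊆q σ Δ) (λ Δ⊆ → Δ⊈σ (⊆-trans Δ⊆ (p∩q⊆p σ Δ)))) (⊆⇒⊆ᵇ (p∩q⊆q σ Γ))

∉∂*⇒⊇ : σ ⊆ Δ ∪ Γ → (Δ ∂* Γ) σ ≡ false → Δ ⊆ σ
∉∂*⇒⊇ {σ = σ} {Δ} σ⊆ σ∉Δ∂*Γ =
  decidable-stable (Δ ⊆? σ) λ Δ⊈σ → contradiction (trans (sym (∈∂* σ⊆ Δ⊈σ)) σ∉Δ∂*Γ) λ ()

module _ {n} (K : Cplx n) (Δ Γ : Subset n) (link≡∂ : link Δ K ≐ ∂ Γ) where

  ∂⇒link : ∀ τ → ∂ Γ τ ≡ true → Disjoint Δ τ × K (Δ ∪ τ) ≡ true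
  ∂⇒link τ e = disjᵇ⇒Disjoint (∧-conicalˡ _ _ τ∈link) , ∧-conicalʳ (disjᵇ Δ τ) _ τ∈link
    where
    τ∈link : disjᵇ Δ τ ∧ K (Δ ∪ τ) ≡ true
    τ∈link = trans (link≡∂ τ) e

  link⇒∂ : ∀ τ → Disjoint Δ τ → K (Δ ∪ τ) ≡ true → ∂ Γ τ ≡ true
  link⇒∂ τ Δ∩τ=∅ Δ∪τ∈K = trans (sym (link≡∂ τ)) (cong₂ _∧_ (Disjoint⇒disjᵇ Δ∩τ=∅) Δ∪τ∈K)

  link-∂⇒∈ : Nonempty Γ → K Δ ≡ true
  link-∂⇒∈ (x , x∈Γ) =
    subst (λ ρ → K ρ ≡ true) (∪-identityʳ Δ) (proj₂ (∂⇒link ∅ (∂⁺ ⊥⊆ (λ Γ⊆∅ → ∉⊥ (Γ⊆∅ x∈Γ)))))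

  link-∂⇒facet : ∀ {v} → v ∈ Γ → K (Δ ∪ (Γ - v)) ≡ true
  link-∂⇒facet {v} v∈Γ = proj₂ (∂⇒link (Γ - v) (⊂⇒∂ (x∈p⇒p-x⊂p v∈Γ)))

  link-∂⇒disjoint : 2 ≤ ∣ Γ ∣ → Disjoint Δ Γ
  link-∂⇒disjoint 2≤∣Γ∣ {x} x∈Δ x∈Γ = proj₁ (∂⇒link ⁅ x ⁆ (∂⁺ ⁅x⁆⊆Γ Γ⊈⁅x⁆)) x∈Δ (x∈⁅x⁆ x)
    where
    ⁅x⁆⊆Γ : ⁅ x ⁆ ⊆ Γ
    ⁅x⁆⊆Γ y∈⁅x⁆ rewrite x∈⁅y⁆⇒x≡y x y∈⁅x⁆ = x∈Γ
    Γ⊈⁅x⁆ : Γ ⊈ ⁅ x ⁆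
    Γ⊈⁅x⁆ Γ⊆⁅x⁆ = n≮n 1 (≤-trans 2≤∣Γ∣ (subst (∣ Γ ∣ ≤_) (∣⁅x⁆∣≡1 x) (p⊆q⇒∣p∣≤∣q∣ Γ⊆⁅x⁆)))

  star⊆join : ∀ {σ} → Disjoint Δ Γ → K σ ≡ true → Δ ⊆ σ → (Δ *∂ Γ) σ ≡ true
  star⊆join {σ} Δ∩Γ=∅ σ∈K Δ⊆σ = ∈*∂ σ⊆Δ∪Γ Γ⊈σ
    where
    σ∖Δ : Subset n
    σ∖Δ = σ ∩ ∁ Δ
    Δ∪σ∖Δ≡σ : Δ ∪ σ∖Δ ≡ σ
    Δ∪σ∖Δ≡σ = p⊆q⇒p∪[q∩∁p]≡q Δ⊆σ
    σ∖Δ⊂Γ : σ∖Δ ⊆ Γ × Γ ⊈ σ∖Δ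
    σ∖Δ⊂Γ = ∂⁻ (link⇒∂ σ∖Δ (λ x∈Δ x∈σ∖Δ → x∈∁p⇒x∉p (p∩q⊆q σ (∁ Δ) x∈σ∖Δ) x∈Δ)
                          (subst (λ ρ → K ρ ≡ true) (sym Δ∪σ∖Δ≡σ) σ∈K))
    σ⊆Δ∪Γ : σ ⊆ Δ ∪ Γ
    σ⊆Δ∪Γ x∈σ = x∈p∪q⁺ (map id (proj₁ σ∖Δ⊂Γ) (x∈p∪q⁻ Δ σ∖Δ (subst (_ ∈_) (sym Δ∪σ∖Δ≡σ) x∈σ)))
    Γ⊈σ : Γ ⊈ σ
    Γ⊈σ Γ⊆σ = proj₂ σ∖Δ⊂Γ λ x∈Γ → x∈p∩q⁺ (Γ⊆σ x∈Γ , x∉p⇒x∈∁p (λ x∈Δ → Δ∩Γ=∅ x∈Δ x∈Γ))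

rot : Triple n → Triple n
rot (triple A B C) = triple B C A

distSub-rot : ∀ (T : Triple n) σ → distSub (rot T) σ ≡ distSub T σ
distSub-rot {n} (triple A B C) σ = sym (trans (∨-comm (AB σ) (BC σ ∨ CA σ)) (∨-assoc (BC σ) (CA σ) (AB σ)))
  where
  AB BC CA : Cplx n
  AB = A *∂ B
  BC = B *∂ C
  CA = C *∂ A

distinguished-rot : ∀ {d} → IsDistinguishedTriple d K T → IsDistinguishedTriple d K (rot T)
distinguished-rot dt = record
  { size₁ = size₂ dt ; size₂ = size₃ dt ; size₃ = size₁ dt
  ; link₁ = link₂ dt ; link₂ = link₃ dt ; link₃ = link₁ dt }

DisjointInteriors : ℕ → Triple n → Triple n → Set
DisjointInteriors {n} d T₁ T₂ =
  ∀ (σ : Subset n) → ∣ σ ∣ ≡ d + 1 → ¬ ((distSub T₁ σ ≡ true) × (distSub T₂ σ ≡ true))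

module _ {d : ℕ} where

  disjointInteriors-sym : DisjointInteriors d T₁ T₂ → DisjointInteriors d T₂ T₁
  disjointInteriors-sym disj σ size (σ∈J₂ , σ∈J₁) = disj σ size (σ∈J₁ , σ∈J₂)

  disjointInteriors-rotˡ : DisjointInteriors d T₁ T₂ → DisjointInteriors d (rot T₁) T₂
  disjointInteriors-rotˡ {T₁ = T₁} disj σ size (σ∈J₁ , σ∈J₂) =
    disj σ size (trans (sym (distSub-rot T₁ σ)) σ∈J₁ , σ∈J₂)

  disjointInteriors-rotʳ : DisjointInteriors d T₁ T₂ → DisjointInteriors d T₁ (rot T₂)
  disjointInteriors-rotʳ disj =
    disjointInteriors-sym (disjointInteriors-rotˡ (disjointInteriors-sym disj))

InSomePair : Triple n → Subset n → Set
InSomePair T σ = σ ⊆ Δ₁ T ∪ Δ₂ T ⊎ σ ⊆ Δ₂ T ∪ Δ₃ T ⊎ σ ⊆ Δ₃ T ∪ Δ₁ T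

ContainsFace : Triple n → Subset n → Set
ContainsFace T σ = Δ₁ T ⊆ σ ⊎ Δ₂ T ⊆ σ ⊎ Δ₃ T ⊆ σ

Untouched : Triple n → Subset n → Set
Untouched T σ = distSub T σ ≡ false × distSub~ T σ ≡ false

∨-true : ∀ x {y} → x ∨ y ≡ true → x ≡ true ⊎ y ≡ true
∨-true true _ = inj₁ refl
∨-true false y≡true = inj₂ y≡true

∨-false : ∀ x {y} → x ∨ y ≡ false → x ≡ false × y ≡ false
∨-false false y≡false = refl , y≡false

Δ₁*∂Δ₂⊆J : ∀ (T : Triple n) σ → (Δ₁ T *∂ Δ₂ T) σ ≡ true → distSub T σ ≡ true
Δ₁*∂Δ₂⊆J T σ = cong (_∨ ((Δ₂ T *∂ Δ₃ T) σ ∨ (Δ₃ T *∂ Δ₁ T) σ))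

J⇒InSomePair : ∀ (T : Triple n) σ → distSub T σ ≡ true → InSomePair T σ
J⇒InSomePair (triple A B C) σ σ∈J =
  map (*∂⇒⊆ A B σ) (map (*∂⇒⊆ B C σ) (*∂⇒⊆ C A σ) ∘ ∨-true ((B *∂ C) σ))
      (∨-true ((A *∂ B) σ) σ∈J)

J̃⇒InSomePair : ∀ (T : Triple n) σ → distSub~ T σ ≡ true → InSomePair T σ
J̃⇒InSomePair (triple A B C) σ σ∈J̃ =
  map (∂*⇒⊆ A B σ) (map (∂*⇒⊆ B C σ) (∂*⇒⊆ C A σ) ∘ ∨-true ((B ∂* C) σ))
      (∨-true ((A ∂* B) σ) σ∈J̃)

J∖J̃⇒ContainsFace : ∀ (T : Triple n) σ → distSub T σ ≡ true → distSub~ T σ ≡ false → ContainsFace T σ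
J∖J̃⇒ContainsFace (triple A B C) σ σ∈J σ∉J̃
  with ∨-false ((A ∂* B) σ) σ∉J̃ | ∨-true ((A *∂ B) σ) σ∈J
... | σ∉AB , _ | inj₁ σ∈AB = inj₁ (∉∂*⇒⊇ (*∂⇒⊆ A B σ σ∈AB) σ∉AB)
... | _ , σ∉J̃′ | inj₂ σ∈J′ with ∨-false ((B ∂* C) σ) σ∉J̃′ | ∨-true ((B *∂ C) σ) σ∈J′
...   | σ∉BC , _ | inj₁ σ∈BC = inj₂ (inj₁ (∉∂*⇒⊇ (*∂⇒⊆ B C σ σ∈BC) σ∉BC))
...   | _ , σ∉CA | inj₂ σ∈CA = inj₂ (inj₂ (∉∂*⇒⊇ (*∂⇒⊆ C A σ σ∈CA) σ∉CA))

position : ∀ (T : Triple n) σ → Untouched T σ ⊎ ContainsFace T σ ⊎ distSub~ T σ ≡ true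
position T σ with distSub T σ in σ∈?J | distSub~ T σ in σ∈?J̃
... | _     | true  = inj₂ (inj₂ refl)
... | false | false = inj₁ (refl , refl)
... | true  | false = inj₂ (inj₁ (J∖J̃⇒ContainsFace T σ σ∈?J σ∈?J̃))

flip-untouched : ∀ (L : Cplx n) T σ → Untouched T σ → tripleFlip L T σ ≡ L σ
flip-untouched L T σ (σ∉J , σ∉J̃) = begin
  (L σ ∧ not (distSub T σ)) ∨ distSub~ T σ ≡⟨ cong₂ (λ j j̃ → (L σ ∧ not j) ∨ j̃) σ∉J σ∉J̃ ⟩
  (L σ ∧ true) ∨ false                    ≡⟨ ∨-identityʳ _ ⟩
  L σ ∧ true                              ≡⟨ ∧-identityʳ _ ⟩
  L σ                                     ∎
  where open ≡-Reasoning

flip-J̃ : ∀ (L : Cplx n) T σ → distSub~ T σ ≡ true → tripleFlip L T σ ≡ true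
flip-J̃ L T σ σ∈J̃ = trans (cong ((L σ ∧ not (distSub T σ)) ∨_) σ∈J̃) (∨-zeroʳ _)

untouched-flips-commute : ∀ (L : Cplx n) T₁ T₂ σ → Untouched T₁ σ →
  tripleFlip (tripleFlip L T₁) T₂ σ ≡ tripleFlip (tripleFlip L T₂) T₁ σ
untouched-flips-commute L T₁ T₂ σ untouched = begin
  tripleFlip (tripleFlip L T₁) T₂ σ ≡⟨ cong (λ b → (b ∧ not (distSub T₂ σ)) ∨ distSub~ T₂ σ)
                                           (flip-untouched L T₁ σ untouched) ⟩
  tripleFlip L T₂ σ                 ≡⟨ flip-untouched (tripleFlip L T₂) T₁ σ untouched ⟨
  tripleFlip (tripleFlip L T₂) T₁ σ ∎
  where open ≡-Reasoning

flips-commute-at : ∀ (L : Cplx n) T₁ T₂ σ →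
  Untouched T₁ σ ⊎ Untouched T₂ σ ⊎ (distSub~ T₁ σ ≡ true × distSub~ T₂ σ ≡ true) →
  tripleFlip (tripleFlip L T₁) T₂ σ ≡ tripleFlip (tripleFlip L T₂) T₁ σ
flips-commute-at L T₁ T₂ σ (inj₁ untouched₁) = untouched-flips-commute L T₁ T₂ σ untouched₁
flips-commute-at L T₁ T₂ σ (inj₂ (inj₁ untouched₂)) = sym (untouched-flips-commute L T₂ T₁ σ untouched₂)
flips-commute-at L T₁ T₂ σ (inj₂ (inj₂ (σ∈J̃₁ , σ∈J̃₂))) =
  trans (flip-J̃ (tripleFlip L T₁) T₂ σ σ∈J̃₂) (sym (flip-J̃ (tripleFlip L T₂) T₁ σ σ∈J̃₁))

half+1+half : ∀ {d} → 2 ∣ d → d / 2 + 1 + d / 2 ≡ d + 1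
half+1+half {d} 2∣d = begin
  d / 2 + 1 + d / 2         ≡⟨ +-assoc (d / 2) 1 (d / 2) ⟩
  d / 2 + suc (d / 2)       ≡⟨ +-suc (d / 2) (d / 2) ⟩
  suc (d / 2 + d / 2)       ≡⟨ cong (λ m → suc (d / 2 + m)) (+-identityʳ (d / 2)) ⟨
  suc (d / 2 + (d / 2 + 0)) ≡⟨ cong suc (m*[n/m]≡n 2∣d) ⟩
  suc d                     ≡⟨ +-comm 1 d ⟩
  d + 1                     ∎
  where open ≡-Reasoning

module _ {n d : ℕ} {K : Cplx n} (2≤d : 2 ≤ d) where

  private
    Distinguished : Triple n → Set
    Distinguished = IsDistinguishedTriple d K

  2≤∣Δ₂∣ : Distinguished T → 2 ≤ ∣ Δ₂ T ∣
  2≤∣Δ₂∣ dt = subst (2 ≤_) (sym (size₂ dt)) (+-monoˡ-≤ 1 (m≥n⇒m/n>0 2≤d))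

  Δ₂-nonempty : Distinguished T → Nonempty (Δ₂ T)
  Δ₂-nonempty dt = ∣p∣>0⇒nonempty (≤-trans (s≤s z≤n) (2≤∣Δ₂∣ dt))

  Δ₁-Δ₂-disjoint : Distinguished T → Disjoint (Δ₁ T) (Δ₂ T)
  Δ₁-Δ₂-disjoint {T = T} dt = link-∂⇒disjoint K (Δ₁ T) (Δ₂ T) (link₁ dt) (2≤∣Δ₂∣ dt)

  module _ (2∣d : 2 ∣ d) where

    facet-size : Distinguished T → v ∈ Δ₂ T → ∣ Δ₁ T ∪ (Δ₂ T - v) ∣ ≡ d + 1
    facet-size {T = T} {v} dt v∈Δ₂ = begin
      ∣ Δ₁ T ∪ (Δ₂ T - v) ∣   ≡⟨ disjoint⇒∣p∪q∣≡∣p∣+∣q∣ (Δ₁ T) (Δ₂ T - v) Δ₁∩[Δ₂-v]=∅ ⟩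
      ∣ Δ₁ T ∣ + ∣ Δ₂ T - v ∣ ≡⟨ cong₂ _+_ (size₁ dt) ∣Δ₂-v∣≡d/2 ⟩
      d / 2 + 1 + d / 2       ≡⟨ half+1+half 2∣d ⟩
      d + 1                   ∎
      where
      open ≡-Reasoning
      Δ₁∩[Δ₂-v]=∅ : Disjoint (Δ₁ T) (Δ₂ T - v)
      Δ₁∩[Δ₂-v]=∅ x∈Δ₁ x∈Δ₂-v = Δ₁-Δ₂-disjoint dt x∈Δ₁ (p─q⊆p (Δ₂ T) ⁅ v ⁆ x∈Δ₂-v)
      ∣Δ₂-v∣≡d/2 : ∣ Δ₂ T - v ∣ ≡ d / 2
      ∣Δ₂-v∣≡d/2 = suc-injective (begin
        suc ∣ Δ₂ T - v ∣ ≡⟨ x∈p⇒suc∣p-x∣≡∣p∣ (Δ₂ T) v v∈Δ₂ ⟩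
        ∣ Δ₂ T ∣         ≡⟨ size₂ dt ⟩
        d / 2 + 1        ≡⟨ +-comm (d / 2) 1 ⟩
        suc (d / 2)      ∎)

    common-facet : Distinguished T₁ → Distinguished T₂ →
      v ∈ Δ₂ T₁ → v ∉ Δ₁ T₂ → Δ₁ T₂ ⊆ Δ₁ T₁ ∪ Δ₂ T₁ → ¬ DisjointInteriors d T₁ T₂
    common-facet {T₁ = T₁} {T₂} {v} dt₁ dt₂ v∈A₂ v∉B₁ B₁⊆A₁∪A₂ disj =
      disj D (facet-size dt₁ v∈A₂) (Δ₁*∂Δ₂⊆J T₁ D D∈A₁*∂A₂ , Δ₁*∂Δ₂⊆J T₂ D D∈B₁*∂B₂)
      where
      D : Subset n
      D = Δ₁ T₁ ∪ (Δ₂ T₁ - v)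
      D∈K : K D ≡ true
      D∈K = link-∂⇒facet K (Δ₁ T₁) (Δ₂ T₁) (link₁ dt₁) v∈A₂
      v∉D : v ∉ D
      v∉D v∈D = [ (λ v∈A₁ → Δ₁-Δ₂-disjoint dt₁ v∈A₁ v∈A₂) , x∉p-x (Δ₂ T₁) v ] (x∈p∪q⁻ _ _ v∈D)
      D⊆A₁∪A₂ : D ⊆ Δ₁ T₁ ∪ Δ₂ T₁
      D⊆A₁∪A₂ x∈D = x∈p∪q⁺ (map id (p─q⊆p _ _) (x∈p∪q⁻ _ _ x∈D))
      B₁⊆D : Δ₁ T₂ ⊆ D
      B₁⊆D {x} x∈B₁ = x∈p∪q⁺ (map id x∈Δ₂-v (x∈p∪q⁻ _ _ (B₁⊆A₁∪A₂ x∈B₁)))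
        where
        x∈Δ₂-v : x ∈ Δ₂ T₁ → x ∈ Δ₂ T₁ - v
        x∈Δ₂-v x∈A₂ = x∈p∧x≢y⇒x∈p-y x∈A₂ λ { refl → v∉B₁ x∈B₁ }
      D∈A₁*∂A₂ : (Δ₁ T₁ *∂ Δ₂ T₁) D ≡ true
      D∈A₁*∂A₂ = ∈*∂ D⊆A₁∪A₂ (λ A₂⊆D → v∉D (A₂⊆D v∈A₂))
      D∈B₁*∂B₂ : (Δ₁ T₂ *∂ Δ₂ T₂) D ≡ true
      D∈B₁*∂B₂ = star⊆join K (Δ₁ T₂) (Δ₂ T₂) (link₁ dt₂) (Δ₁-Δ₂-disjoint dt₂) D∈K B₁⊆D

    Δ₁⊈Δ₁∪Δ₂ : Distinguished T₁ → Distinguished T₂ → DisjointInteriors d T₁ T₂ → Δ₁ T₂ ⊈ Δ₁ T₁ ∪ Δ₂ T₁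
    Δ₁⊈Δ₁∪Δ₂ {T₁ = T₁} {T₂} dt₁ dt₂ disj B₁⊆A₁∪A₂ with ⊆-or-∃∉ (Δ₂ T₁) (Δ₁ T₂)
    ... | inj₂ (v , v∈A₂ , v∉B₁) = common-facet dt₁ dt₂ v∈A₂ v∉B₁ B₁⊆A₁∪A₂ disj
    ... | inj₁ A₂⊆B₁ =
      common-facet (distinguished-rot dt₁) dt₂ w∈A₃ w∉B₁ B₁⊆A₂∪A₃ (disjointInteriors-rotˡ disj)
      where
      B₁∈K : K (Δ₁ T₂) ≡ true
      B₁∈K = link-∂⇒∈ K (Δ₁ T₂) (Δ₂ T₂) (link₁ dt₂) (Δ₂-nonempty dt₂)
      B₁⊆A₂∪A₃ : Δ₁ T₂ ⊆ Δ₂ T₁ ∪ Δ₃ T₁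
      B₁⊆A₂∪A₃ = *∂⇒⊆ (Δ₂ T₁) (Δ₃ T₁) (Δ₁ T₂)
        (star⊆join K (Δ₂ T₁) (Δ₃ T₁) (link₂ dt₁) (Δ₁-Δ₂-disjoint (distinguished-rot dt₁)) B₁∈K A₂⊆B₁)
      w : Fin n
      w = proj₁ (Δ₂-nonempty (distinguished-rot dt₁))
      w∈A₃ : w ∈ Δ₃ T₁
      w∈A₃ = proj₂ (Δ₂-nonempty (distinguished-rot dt₁))
      w∉B₁ : w ∉ Δ₁ T₂
      w∉B₁ w∈B₁ = [ Δ₁-Δ₂-disjoint (distinguished-rot (distinguished-rot dt₁)) w∈A₃
                  , (λ w∈A₂ → Δ₁-Δ₂-disjoint (distinguished-rot dt₁) w∈A₂ w∈A₃)
                  ] (x∈p∪q⁻ _ _ (B₁⊆A₁∪A₂ w∈B₁))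

    Δ₁-in-no-pair : Distinguished T₁ → Distinguished T₂ → DisjointInteriors d T₁ T₂ →
      Δ₁ T₂ ⊆ σ → ¬ InSomePair T₁ σ
    Δ₁-in-no-pair dt₁ dt₂ disj B₁⊆σ (inj₁ σ⊆) =
      Δ₁⊈Δ₁∪Δ₂ dt₁ dt₂ disj (⊆-trans B₁⊆σ σ⊆)
    Δ₁-in-no-pair dt₁ dt₂ disj B₁⊆σ (inj₂ (inj₁ σ⊆)) =
      Δ₁⊈Δ₁∪Δ₂ (distinguished-rot dt₁) dt₂ (disjointInteriors-rotˡ disj) (⊆-trans B₁⊆σ σ⊆)
    Δ₁-in-no-pair dt₁ dt₂ disj B₁⊆σ (inj₂ (inj₂ σ⊆)) =
      Δ₁⊈Δ₁∪Δ₂ (distinguished-rot (distinguished-rot dt₁)) dt₂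
        (disjointInteriors-rotˡ (disjointInteriors-rotˡ disj)) (⊆-trans B₁⊆σ σ⊆)

    face-in-no-pair : Distinguished T₁ → Distinguished T₂ → DisjointInteriors d T₁ T₂ →
      ContainsFace T₂ σ → ¬ InSomePair T₁ σ
    face-in-no-pair dt₁ dt₂ disj (inj₁ B₁⊆σ) =
      Δ₁-in-no-pair dt₁ dt₂ disj B₁⊆σ
    face-in-no-pair dt₁ dt₂ disj (inj₂ (inj₁ B₂⊆σ)) =
      Δ₁-in-no-pair dt₁ (distinguished-rot dt₂) (disjointInteriors-rotʳ disj) B₂⊆σ
    face-in-no-pair dt₁ dt₂ disj (inj₂ (inj₂ B₃⊆σ)) =
      Δ₁-in-no-pair dt₁ (distinguished-rot (distinguished-rot dt₂))
        (disjointInteriors-rotʳ (disjointInteriors-rotʳ disj)) B₃⊆σ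

    face-untouched : Distinguished T₁ → Distinguished T₂ → DisjointInteriors d T₁ T₂ →
      ContainsFace T₂ σ → Untouched T₁ σ
    face-untouched {T₁ = T₁} {σ = σ} dt₁ dt₂ disj face =
        ¬-not (λ σ∈J → face-in-no-pair dt₁ dt₂ disj face (J⇒InSomePair T₁ σ σ∈J))
      , ¬-not (λ σ∈J̃ → face-in-no-pair dt₁ dt₂ disj face (J̃⇒InSomePair T₁ σ σ∈J̃))

    flip-preserves-link₁ : Distinguished T₁ → Distinguished T₂ → DisjointInteriors d T₁ T₂ →
      link (Δ₁ T₂) (tripleFlip K T₁) ≐ ∂ (Δ₂ T₂)
    flip-preserves-link₁ {T₁ = T₁} {T₂} dt₁ dt₂ disj τ = begin
      disjᵇ (Δ₁ T₂) τ ∧ tripleFlip K T₁ (Δ₁ T₂ ∪ τ) ≡⟨ cong (disjᵇ (Δ₁ T₂) τ ∧_) unchanged ⟩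
      link (Δ₁ T₂) K τ                              ≡⟨ link₁ dt₂ τ ⟩
      ∂ (Δ₂ T₂) τ                                   ∎
      where
      open ≡-Reasoning
      unchanged : tripleFlip K T₁ (Δ₁ T₂ ∪ τ) ≡ K (Δ₁ T₂ ∪ τ)
      unchanged = flip-untouched K T₁ _ (face-untouched dt₁ dt₂ disj (inj₁ (p⊆p∪q τ)))

    flip-preserves-distinguished : Distinguished T₁ → Distinguished T₂ → DisjointInteriors d T₁ T₂ →
      IsDistinguishedTriple d (tripleFlip K T₁) T₂
    flip-preserves-distinguished dt₁ dt₂ disj = record
      { size₁ = size₁ dt₂ ; size₂ = size₂ dt₂ ; size₃ = size₃ dt₂
      ; link₁ = flip-preserves-link₁ dt₁ dt₂ disj
      ; link₂ = flip-preserves-link₁ dt₁ (distinguished-rot dt₂) (disjointInteriors-rotʳ disj)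
      ; link₃ = flip-preserves-link₁ dt₁ (distinguished-rot (distinguished-rot dt₂))
                  (disjointInteriors-rotʳ (disjointInteriors-rotʳ disj)) }

    untouched-or-in-both-J̃ : Distinguished T₁ → Distinguished T₂ → DisjointInteriors d T₁ T₂ → ∀ σ →
      Untouched T₁ σ ⊎ Untouched T₂ σ ⊎ (distSub~ T₁ σ ≡ true × distSub~ T₂ σ ≡ true)
    untouched-or-in-both-J̃ {T₁ = T₁} {T₂} dt₁ dt₂ disj σ with position T₁ σ | position T₂ σ
    ... | inj₁ untouched₁ | _ = inj₁ untouched₁
    ... | _ | inj₁ untouched₂ = inj₂ (inj₁ untouched₂)
    ... | inj₂ (inj₁ face₁) | _ = inj₂ (inj₁ (face-untouched dt₂ dt₁ (disjointInteriors-sym disj) face₁))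
    ... | _ | inj₂ (inj₁ face₂) = inj₁ (face-untouched dt₁ dt₂ disj face₂)
    ... | inj₂ (inj₂ σ∈J̃₁) | inj₂ (inj₂ σ∈J̃₂) = inj₂ (inj₂ (σ∈J̃₁ , σ∈J̃₂))

    flips-commute : Distinguished T₁ → Distinguished T₂ → DisjointInteriors d T₁ T₂ →
      tripleFlip (tripleFlip K T₁) T₂ ≐ tripleFlip (tripleFlip K T₂) T₁
    flips-commute {T₁ = T₁} {T₂} dt₁ dt₂ disj σ =
      flips-commute-at K T₁ T₂ σ (untouched-or-in-both-J̃ dt₁ dt₂ disj σ)

even-and-≥2 : ∀ {d} → d ≡ 2 ⊎ d ≡ 4 ⊎ d ≡ 8 ⊎ d ≡ 16 → 2 ∣ d × 2 ≤ d
even-and-≥2 (inj₁ refl) = divides 1 refl , s≤s (s≤s z≤n)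
even-and-≥2 (inj₂ (inj₁ refl)) = divides 2 refl , s≤s (s≤s z≤n)
even-and-≥2 (inj₂ (inj₂ (inj₁ refl))) = divides 4 refl , s≤s (s≤s z≤n)
even-and-≥2 (inj₂ (inj₂ (inj₂ refl))) = divides 8 refl , s≤s (s≤s z≤n)

proposition7p3 : (d : ℕ) → (d ≡ 2 ⊎ d ≡ 4 ⊎ d ≡ 8 ⊎ d ≡ 16) →
    (n : ℕ) → n ≡ 3 * (d / 2) + 3 →
    (K : Cplx n) → CombManifold d K → LikeProjectivePlane K →
    (T₁ T₂ : Triple n) →
    IsDistinguishedTriple d K T₁ → IsDistinguishedTriple d K T₂ →
    (∀ (σ : Subset n) → ∣ σ ∣ ≡ d + 1 →
       ¬ ((distSub T₁ σ ≡ true) × (distSub T₂ σ ≡ true))) →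
    IsDistinguishedTriple d (tripleFlip K T₁) T₂ ×
    IsDistinguishedTriple d (tripleFlip K T₂) T₁ ×
    (tripleFlip (tripleFlip K T₁) T₂ ≐ tripleFlip (tripleFlip K T₂) T₁)
proposition7p3 d d∈ _ _ K _ _ T₁ T₂ dt₁ dt₂ disj =
    flip-preserves-distinguished 2≤d 2∣d dt₁ dt₂ disj
  , flip-preserves-distinguished 2≤d 2∣d dt₂ dt₁ (disjointInteriors-sym disj)
  , flips-commute 2≤d 2∣d dt₁ dt₂ disj
  where
  2∣d : 2 ∣ d
  2∣d = proj₁ (even-and-≥2 d∈)
  2≤d : 2 ≤ d
  2≤d = proj₂ (even-and-≥2 d∈)
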